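{- Let $\beta_3 \in S_n$ be a $3$-cycle. Then \begin{enumerate} \item $c(0, \beta_3)=3(n-3)!$ for $n\geq 3$; \item $c(3, \beta_3)=(3(n-3)+1)\cdot 3(n-3)!$ for $n\geq 3$; \item $c(4, \beta_3)=3(n-3)\cdot 3(n-3)!$ for $n\geq 4$; \item $c(5, \beta_3)=6\binom{n-3}{2}\cdot 3(n-3)!$ for $n\geq 5$; \item $c(6, \beta_3)=2\binom{n-3}{3}\cdot 3(n-3)!$ for $n\geq 6$; \item $c(k, \beta_3)=0$ for every integer $k$ with $7 \leq k \leq n$. \end{enumerate}
   Context: $S_n$ is the group of permutations of $[n]=\{1,\dots,n\}$; products are composed right to left. The Hamming distance between $\sigma,\tau\in S_n$ is $H(\sigma,\tau)=|\{a\in[n]:\sigma(a)\neq\tau(a)\}|$. Two permutations $\alpha,\beta\in S_n$ $k$-commute if $H(\alpha\beta,\beta\alpha)=k$. For $\beta\in S_n$ and a nonnegative integer $k$, $c(k,\beta)$ denotes the number of $\alpha\in S_n$ that $k$-commute with $\beta$. A $3$-cycle in $S_n$ is a permutation whose disjoint cycle factorization consists of one cycle of length $3$ and $n-3$ fixed points. -}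

module Defs where

open import Data.Nat using (ℕ; zero; suc)
open import Data.Fin using (Fin; zero; suc)
open import Data.Fin.Properties using (_≟_)
open import Data.List using (List; []; _∷_; map; concatMap; allFin; length; filter)
open import Data.Product using (Σ; _×_; _,_)
open import Function using (_∘_)
open import Function.Definitions using (Injective)
open import Relation.Nullary using (¬_; Dec; yes; no)
open import Relation.Binary.PropositionalEquality using (_≡_; _≢_)

-- A permutation of [n] = Fin n is an injective (hence bijective) map Fin n → Fin n.
IsPerm : {n : ℕ} → (Fin n → Fin n) → Set
IsPerm f = Injective _≡_ _≡_ f

allFuns : (m n : ℕ) → List (Fin m → Fin n)
allFuns zero n = (λ ()) ∷ []
allFuns (suc m) n =
  concatMap (λ (b : Fin n) → map (λ (g : Fin m → Fin n) → λ { zero → b ; (suc i) → g i }) (allFuns m n))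
            (allFin n)

private
  allDec : {m : ℕ} (P : Fin m → Set) → ((i : Fin m) → Dec (P i)) → Dec ((i : Fin m) → P i)
  allDec {zero} P d = yes (λ ())
  allDec {suc m} P d with d zero | allDec (P ∘ suc) (d ∘ suc)
  ... | yes p | yes q = yes (λ { zero → p ; (suc i) → q i })
  ... | no ¬p | _ = no (λ h → ¬p (h zero))
  ... | yes _ | no ¬q = no (λ h → ¬q (h ∘ suc))

  impDec : {A B : Set} → Dec A → Dec B → Dec (A → B)
  impDec _ (yes b) = yes (λ _ → b)
  impDec (yes a) (no ¬b) = no (λ f → ¬b (f a))
  impDec (no ¬a) _ = yes (λ a → Data.Empty.⊥-elim (¬a a))
    where import Data.Empty

isPerm? : {n : ℕ} (f : Fin n → Fin n) → Dec (IsPerm f)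
isPerm? {n} f with allDec (λ x → (y : Fin n) → f x ≡ f y → x ≡ y)
                          (λ x → allDec _ (λ y → impDec (f x ≟ f y) (x ≟ y)))
... | yes h = yes (λ {x} {y} → h x y)
... | no ¬h = no (λ inj → ¬h (λ x y → inj))

countFin : {n : ℕ} → (P : Fin n → Set) → ((i : Fin n) → Dec (P i)) → ℕ
countFin {n} P d = length (filter d (allFin n))

H : {n : ℕ} → (Fin n → Fin n) → (Fin n → Fin n) → ℕ
H σ τ = countFin (λ a → σ a ≢ τ a) (λ a → ¬? (σ a ≟ τ a))
  where open import Relation.Nullary using (¬?)

-- α and β k-commute: H(αβ, βα) = k (composition right to left).
KCommute : {n : ℕ} → ℕ → (Fin n → Fin n) → (Fin n → Fin n) → Set
KCommute k α β = H (α ∘ β) (β ∘ α) ≡ k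

c : {n : ℕ} → ℕ → (Fin n → Fin n) → ℕ
c {n} k β = length (filter (λ α → isPerm? α ×-dec (H (α ∘ β) (β ∘ α) Data.Nat.≟ k)) (allFuns n n))
  where
    open import Relation.Nullary using (_×-dec_)
    import Data.Nat

Is3Cycle : {n : ℕ} → (Fin n → Fin n) → Set
Is3Cycle {n} β = Σ (Fin n) λ a → Σ (Fin n) λ b → Σ (Fin n) λ d →
  (a ≢ b) × (b ≢ d) × (a ≢ d) ×
  (β a ≡ b) × (β b ≡ d) × (β d ≡ a) ×
  ((x : Fin n) → x ≢ a → x ≢ b → x ≢ d → β x ≡ x)

-- Let β send special points pts j to pts (next j), next without fixed points,
-- and fix all other points of [n].  The pattern of a permutation α records, for
-- each special point, whether α maps it outside the special points or onto which
-- one.  H(αβ, βα) depends only on this pattern (`hamming`: mismatches along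
-- next, plus the special points sent outside).  Counting permutations pattern by
-- pattern: the values of α at the special points form an injection g, every
-- injection extends to (n − m)! permutations, and the injections with a valid
-- pattern p number (n − m)(n − m − 1)⋯ over the outside positions of p.  Both
-- counts are instances of one lemma on injections with prescribed values
-- (`count-realising`), proved by induction along the enumeration allFuns.  So
-- c(k, β) = patternSum k (n − m) · (n − m)! (`count-k-commuting`); for the
-- 3-cycle the sum over the 64 patterns, grouped by their number of outside
-- positions, gives the polynomials in n − 3 of the theorem.

module Submission where

open import Defs
open import Data.Bool using (Bool; true; false; _∧_; _∨_; not)
open import Data.Bool.Properties using (∧-comm; ∧-identityʳ; ∧-zeroʳ)
open import Data.Empty using (⊥; ⊥-elim)
open import Data.Fin using (Fin; zero; suc; punchOut; toℕ; fromℕ<)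
open import Data.Fin.Properties using (toℕ-injective; toℕ-fromℕ<; _≟_; all?; any?; suc-injective; 0≢1+n; punchOut-injective; injective⇒≤)
open import Data.List using (List; []; _∷_; _++_; map; concatMap; filter; length; allFin; tabulate)
open import Data.Nat using (ℕ; zero; suc; _+_; _*_; _∸_; _≤_; z≤n; s≤s; _!)
open import Data.Nat.Properties using (∸-monoˡ-≤; m≤m+n; 1+n≰n; *-assoc; +-assoc; +-comm; +-cancelˡ-≡; m+n∸m≡n; ∸-+-assoc; +-identityʳ; *-identityʳ; *-zeroʳ; *-distribˡ-+; *-distribʳ-+)
open import Data.Nat.Properties using () renaming (_≟_ to _≟ℕ_)
open import Data.Nat.Combinatorics using (_C_; nC1≡n; nCn≡1; nCk+nC[k+1]≡[n+1]C[k+1])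
open import Data.Nat.Tactic.RingSolver using (solve-∀)
open import Data.Maybe using (Maybe; just; nothing; is-nothing)
open import Data.Maybe.Properties using (just-injective)
open import Data.Product using (Σ; _×_; _,_; proj₁; proj₂)
open import Data.Sum using (_⊎_; inj₁; inj₂)
open import Function using (_∘_; case_of_)
open import Function.Definitions using (Injective)
open import Relation.Nullary using (Dec; yes; no; does; ¬?; _×-dec_)
open import Relation.Nullary.Decidable using (dec-true; dec-false; map′; _→-dec_)
open import Relation.Binary.PropositionalEquality

private
  variable
    A B : Set

𝟙 : Bool → ℕ
𝟙 true  = 1
𝟙 false = 0

𝟙-∧ : ∀ a b → 𝟙 (a ∧ b) ≡ 𝟙 a * 𝟙 b
𝟙-∧ true  b = sym (+-identityʳ (𝟙 b))
𝟙-∧ false b = refl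

𝟙-not : ∀ b → 𝟙 b + 𝟙 (not b) ≡ 1
𝟙-not true  = refl
𝟙-not false = refl

∧-true : ∀ {a b} → a ∧ b ≡ true → a ≡ true × b ≡ true
∧-true {true} {true} _ = refl , refl

∧-false : ∀ {a b} → (a ≡ true → b ≡ true → ⊥) → a ∧ b ≡ false
∧-false {true}  {true}  h = ⊥-elim (h refl refl)
∧-false {true}  {false} _ = refl
∧-false {false}         _ = refl

not-true : ∀ {b} → not b ≡ true → b ≡ false
not-true {false} _ = refl

∨-false-left : ∀ {a b} → a ∨ b ≡ false → a ≡ false
∨-false-left {false} _ = refl

∨-false-right : ∀ {a b} → a ∨ b ≡ false → b ≡ false
∨-false-right {false} {false} _ = refl

𝟙-∧-* : ∀ a b x → 𝟙 (a ∧ b) * x ≡ 𝟙 a * (𝟙 b * x)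
𝟙-∧-* a b x = trans (cong (_* x) (𝟙-∧ a b)) (*-assoc (𝟙 a) (𝟙 b) x)

true≢false : ∀ {b} → b ≡ true → b ≡ false → ⊥
true≢false refl ()

bool-ext : ∀ {a b} → (a ≡ true → b ≡ true) → (b ≡ true → a ≡ true) → a ≡ b
bool-ext {true}  {true}  _ _ = refl
bool-ext {true}  {false} f _ = sym (f refl)
bool-ext {false} {true}  _ g = g refl
bool-ext {false} {false} _ _ = refl

does-true : ∀ {P : Set} (d : Dec P) → does d ≡ true → P
does-true (yes p) _ = p

_==_ : {n : ℕ} → Fin n → Fin n → Bool
x == y = does (x ≟ y)

module _ {n : ℕ} where

  ==-intro : {x y : Fin n} → x ≡ y → (x == y) ≡ true
  ==-intro {x} {y} = dec-true (x ≟ y)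

  ==-false : {x y : Fin n} → x ≢ y → (x == y) ≡ false
  ==-false {x} {y} = dec-false (x ≟ y)

  ==-true : {x y : Fin n} → (x == y) ≡ true → x ≡ y
  ==-true {x} {y} = does-true (x ≟ y)

  ==-sym : (x y : Fin n) → (x == y) ≡ (y == x)
  ==-sym x y = bool-ext (λ h → ==-intro (sym (==-true {x} {y} h))) (λ h → ==-intro (sym (==-true {y} {x} h)))

==-injective : {m n : ℕ} {f : Fin m → Fin n} → Injective _≡_ _≡_ f →
  ∀ x y → (f x == f y) ≡ (x == y)
==-injective {f = f} inj x y =
  bool-ext (λ h → ==-intro (inj (==-true h))) (λ h → ==-intro (cong f (==-true h)))

∑ : List A → (A → ℕ) → ℕ
∑ []       f = 0
∑ (x ∷ xs) f = f x + ∑ xs f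

syntax ∑ xs (λ x → e) = ∑[ x ∈ xs ] e

count : (A → Bool) → List A → ℕ
count t xs = ∑[ x ∈ xs ] 𝟙 (t x)

∑-cong : {f g : A → ℕ} → (∀ x → f x ≡ g x) → (xs : List A) → ∑ xs f ≡ ∑ xs g
∑-cong h []       = refl
∑-cong h (x ∷ xs) = cong₂ _+_ (h x) (∑-cong h xs)

∑-zero : (xs : List A) → ∑[ x ∈ xs ] 0 ≡ 0
∑-zero []       = refl
∑-zero (x ∷ xs) = ∑-zero xs

∑-+ : (f g : A → ℕ) (xs : List A) → ∑[ x ∈ xs ] (f x + g x) ≡ ∑ xs f + ∑ xs g
∑-+ f g []       = refl
∑-+ f g (x ∷ xs) = trans (cong (f x + g x +_) (∑-+ f g xs)) (interchange (f x) (g x) _ _)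
  where
  interchange : ∀ a b c d → a + b + (c + d) ≡ a + c + (b + d)
  interchange = solve-∀

∑-*ˡ : (c : ℕ) (f : A → ℕ) (xs : List A) → ∑[ x ∈ xs ] (c * f x) ≡ c * ∑ xs f
∑-*ˡ c f []       = sym (*-zeroʳ c)
∑-*ˡ c f (x ∷ xs) = trans (cong (c * f x +_) (∑-*ˡ c f xs)) (sym (*-distribˡ-+ c (f x) _))

∑-*ʳ : (f : A → ℕ) (c : ℕ) (xs : List A) → ∑[ x ∈ xs ] (f x * c) ≡ ∑ xs f * c
∑-*ʳ f c []       = refl
∑-*ʳ f c (x ∷ xs) = trans (cong (f x * c +_) (∑-*ʳ f c xs)) (sym (*-distribʳ-+ c (f x) _))

∑-++ : (f : A → ℕ) (xs ys : List A) → ∑ (xs ++ ys) f ≡ ∑ xs f + ∑ ys f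
∑-++ f []       ys = refl
∑-++ f (x ∷ xs) ys = trans (cong (f x +_) (∑-++ f xs ys)) (sym (+-assoc (f x) _ _))

∑-concatMap : (f : A → ℕ) (h : B → List A) (ys : List B) →
  ∑ (concatMap h ys) f ≡ ∑[ y ∈ ys ] ∑ (h y) f
∑-concatMap f h []       = refl
∑-concatMap f h (y ∷ ys) = trans (∑-++ f (h y) _) (cong (∑ (h y) f +_) (∑-concatMap f h ys))

∑-map : (f : A → ℕ) (h : B → A) (ys : List B) → ∑ (map h ys) f ≡ ∑ ys (f ∘ h)
∑-map f h []       = refl
∑-map f h (y ∷ ys) = cong (f (h y) +_) (∑-map f h ys)

∑-comm : (f : A → B → ℕ) (xs : List A) (ys : List B) →
  ∑[ x ∈ xs ] ∑[ y ∈ ys ] f x y ≡ ∑[ y ∈ ys ] ∑[ x ∈ xs ] f x y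
∑-comm f []       ys = sym (∑-zero ys)
∑-comm f (x ∷ xs) ys =
  trans (cong (∑ ys (f x) +_) (∑-comm f xs ys)) (sym (∑-+ (f x) (λ y → ∑[ x ∈ xs ] f x y) ys))

count-∧ˡ : (b : Bool) (t : A → Bool) (xs : List A) → count (λ x → b ∧ t x) xs ≡ 𝟙 b * count t xs
count-∧ˡ b t xs = trans (∑-cong (λ x → 𝟙-∧ b (t x)) xs) (∑-*ˡ (𝟙 b) (𝟙 ∘ t) xs)

count-none : (t : A → Bool) → (∀ x → t x ≡ false) → (xs : List A) → count t xs ≡ 0
count-none t h xs = trans (∑-cong (λ x → cong 𝟙 (h x)) xs) (∑-zero xs)

length-filter : {P : A → Set} (d : (x : A) → Dec (P x)) (xs : List A) →
  length (filter d xs) ≡ count (λ x → does (d x)) xs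
length-filter d []       = refl
length-filter d (x ∷ xs) with does (d x)
... | true  = cong suc (length-filter d xs)
... | false = length-filter d xs

-- allFin n = tabulate id, so sums over it can be unfolded one point at a time.
∑-tabulate : {n : ℕ} (g : Fin n → A) (f : A → ℕ) → ∑ (tabulate g) f ≡ ∑ (allFin n) (f ∘ g)
∑-tabulate {n = zero}  g f = refl
∑-tabulate {n = suc n} g f =
  cong (f (g zero) +_) (trans (∑-tabulate (g ∘ suc) f) (sym (∑-tabulate suc (f ∘ g))))

∑-allFin-suc : {n : ℕ} (f : Fin (suc n) → ℕ) → ∑ (allFin (suc n)) f ≡ f zero + ∑ (allFin n) (f ∘ suc)
∑-allFin-suc f = cong (f zero +_) (∑-tabulate suc f)

∑-const : (n : ℕ) → ∑[ x ∈ allFin n ] 1 ≡ n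
∑-const zero    = refl
∑-const (suc n) = trans (∑-allFin-suc {n} (λ _ → 1)) (cong suc (∑-const n))

∑-δ : {n : ℕ} (y : Fin n) (f : Fin n → ℕ) → ∑[ x ∈ allFin n ] (𝟙 (y == x) * f x) ≡ f y
∑-δ {suc n} zero f = begin
  ∑[ x ∈ allFin (suc n) ] (𝟙 (zero == x) * f x)  ≡⟨ ∑-allFin-suc (λ x → 𝟙 (zero == x) * f x) ⟩
  f zero + 0 + ∑[ x ∈ allFin n ] 0               ≡⟨ cong (f zero + 0 +_) (∑-zero (allFin n)) ⟩
  f zero + 0 + 0                                  ≡⟨ trans (+-identityʳ _) (+-identityʳ _) ⟩
  f zero                                          ∎
  where open ≡-Reasoning
∑-δ {suc n} (suc y) f = trans (∑-allFin-suc (λ x → 𝟙 (suc y == x) * f x)) (∑-δ y (f ∘ suc))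

∑-δ₁ : {n : ℕ} (y : Fin n) → ∑[ x ∈ allFin n ] 𝟙 (y == x) ≡ 1
∑-δ₁ {n} y = trans (∑-cong (λ x → sym (*-identityʳ (𝟙 (y == x)))) (allFin n)) (∑-δ y (λ _ → 1))

count-split : {n : ℕ} (t : Fin n → Bool) → count t (allFin n) + count (not ∘ t) (allFin n) ≡ n
count-split {n} t = begin
  count t (allFin n) + count (not ∘ t) (allFin n)   ≡⟨ ∑-+ (𝟙 ∘ t) (𝟙 ∘ not ∘ t) (allFin n) ⟨
  ∑[ x ∈ allFin n ] (𝟙 (t x) + 𝟙 (not (t x)))      ≡⟨ ∑-cong (λ x → 𝟙-not (t x)) (allFin n) ⟩
  ∑[ x ∈ allFin n ] 1                               ≡⟨ ∑-const n ⟩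
  n                                                 ∎
  where open ≡-Reasoning

_≐_ : {m N : ℕ} → (Fin m → Fin N) → (Fin m → Fin N) → Bool
_≐_ {zero}  f g = true
_≐_ {suc m} f g = (f zero == g zero) ∧ ((f ∘ suc) ≐ (g ∘ suc))

≐-sound : {m N : ℕ} {f g : Fin m → Fin N} → (f ≐ g) ≡ true → ∀ i → f i ≡ g i
≐-sound {suc m} h zero    = ==-true (proj₁ (∧-true h))
≐-sound {suc m} h (suc i) = ≐-sound (proj₂ (∧-true h)) i

≐-complete : {m N : ℕ} {f g : Fin m → Fin N} → (∀ i → f i ≡ g i) → (f ≐ g) ≡ true
≐-complete {zero}  h = refl
≐-complete {suc m} h rewrite ==-intro (h zero) = ≐-complete (h ∘ suc)

count-allFuns-suc : {m N : ℕ} (T : Fin N → (Fin m → Fin N) → Bool) →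
  count (λ f → T (f zero) (f ∘ suc)) (allFuns (suc m) N) ≡ ∑[ b ∈ allFin N ] count (T b) (allFuns m N)
count-allFuns-suc {m} {N} T =
  trans (∑-concatMap _ _ (allFin N)) (∑-cong (λ b → ∑-map _ _ (allFuns m N)) (allFin N))

allFuns-unique : {m N : ℕ} (f : Fin m → Fin N) → count (f ≐_) (allFuns m N) ≡ 1
allFuns-unique {zero}      f = refl
allFuns-unique {suc m} {N} f = begin
  count (f ≐_) (allFuns (suc m) N)
    ≡⟨ count-allFuns-suc (λ b g → (f zero == b) ∧ ((f ∘ suc) ≐ g)) ⟩
  ∑[ b ∈ allFin N ] count (λ g → (f zero == b) ∧ ((f ∘ suc) ≐ g)) (allFuns m N)
    ≡⟨ ∑-cong (λ b → count-∧ˡ (f zero == b) _ (allFuns m N)) (allFin N) ⟩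
  ∑[ b ∈ allFin N ] (𝟙 (f zero == b) * count ((f ∘ suc) ≐_) (allFuns m N))
    ≡⟨ ∑-δ (f zero) (λ _ → count ((f ∘ suc) ≐_) (allFuns m N)) ⟩
  count ((f ∘ suc) ≐_) (allFuns m N)
    ≡⟨ allFuns-unique (f ∘ suc) ⟩
  1 ∎
  where open ≡-Reasoning

count-partition : {m N : ℕ} (κ : A → (Fin m → Fin N)) (t : A → Bool) (xs : List A) →
  count t xs ≡ ∑[ g ∈ allFuns m N ] count (λ x → t x ∧ (κ x ≐ g)) xs
count-partition {m = m} {N} κ t [] = sym (∑-zero (allFuns m N))
count-partition {m = m} {N} κ t (x ∷ xs) =
  trans (cong₂ _+_ key (count-partition κ t xs))
        (sym (∑-+ (λ g → 𝟙 (t x ∧ (κ x ≐ g))) (λ g → count (λ x → t x ∧ (κ x ≐ g)) xs) (allFuns m N)))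
  where
  key : 𝟙 (t x) ≡ count (λ g → t x ∧ (κ x ≐ g)) (allFuns m N)
  key = sym (trans (count-∧ˡ (t x) (κ x ≐_) (allFuns m N))
                   (trans (cong (𝟙 (t x) *_) (allFuns-unique (κ x))) (*-identityʳ (𝟙 (t x)))))

count-by-key : {m N : ℕ} (κ : A → (Fin m → Fin N)) (W : (Fin m → Fin N) → Bool) →
  (∀ {f g} → (∀ i → f i ≡ g i) → W f ≡ W g) → (t : A → Bool) (xs : List A) →
  count (λ x → t x ∧ W (κ x)) xs ≡ ∑[ g ∈ allFuns m N ] (𝟙 (W g) * count (λ x → t x ∧ (κ x ≐ g)) xs)
count-by-key {m = m} {N} κ W W-resp t xs =
  trans (count-partition κ _ xs)
        (∑-cong (λ g → trans (∑-cong (λ x → cong 𝟙 (regroup (t x) (λ h → W-resp (≐-sound h)))) xs)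
                             (count-∧ˡ (W g) _ xs))
                (allFuns m N))
  where
  regroup : ∀ a {w w′ s} → (s ≡ true → w ≡ w′) → (a ∧ w) ∧ s ≡ w′ ∧ (a ∧ s)
  regroup a {w} {w′} {false} _ = trans (∧-zeroʳ (a ∧ w)) (sym (trans (cong (w′ ∧_) (∧-zeroʳ a)) (∧-zeroʳ w′)))
  regroup a {w} {w′} {true}  h rewrite h refl =
    trans (∧-identityʳ (a ∧ w′)) (trans (∧-comm a w′) (cong (w′ ∧_) (sym (∧-identityʳ a))))

-- Injections with prescribed values.
--
-- A prescription assigns to each position of Fin m either a value or nothing
-- ("free"). We count the injective maps that take the prescribed values and
-- send the free positions outside a given set F of already used values.

falling : ℕ → ℕ → ℕ
falling k zero    = 1
falling k (suc r) = k * falling (k ∸ 1) r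

falling-diag : ∀ k → falling k k ≡ k !
falling-diag zero    = refl
falling-diag (suc k) = cong (suc k *_) (falling-diag k)

Prescription : ℕ → ℕ → Set
Prescription m N = Fin m → Maybe (Fin N)

free : {m N : ℕ} → Prescription m N → ℕ
free {m} pre = count (λ i → is-nothing (pre i)) (allFin m)

size : {N : ℕ} → (Fin N → Bool) → ℕ
size {N} F = count F (allFin N)

insert : {N : ℕ} → (Fin N → Bool) → Fin N → (Fin N → Bool)
insert F b y = F y ∨ (b == y)

size-insert : {N : ℕ} (F : Fin N → Bool) (b : Fin N) → F b ≡ false → size (insert F b) ≡ suc (size F)
size-insert {N} F b Fb≡false = begin
  size (insert F b)                                   ≡⟨ ∑-cong split (allFin N) ⟩
  ∑[ y ∈ allFin N ] (𝟙 (F y) + 𝟙 (b == y))            ≡⟨ ∑-+ (𝟙 ∘ F) (λ y → 𝟙 (b == y)) (allFin N) ⟩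
  size F + ∑[ y ∈ allFin N ] 𝟙 (b == y)               ≡⟨ cong (size F +_) (∑-δ₁ b) ⟩
  size F + 1                                          ≡⟨ +-comm (size F) 1 ⟩
  suc (size F)                                        ∎
  where
  open ≡-Reasoning
  split : ∀ y → 𝟙 (F y ∨ (b == y)) ≡ 𝟙 (F y) + 𝟙 (b == y)
  split y with b ≟ y
  ... | yes refl rewrite Fb≡false = refl
  ... | no _ with F y
  ...   | true  = refl
  ...   | false = refl

count-not : {N : ℕ} (F : Fin N → Bool) → count (not ∘ F) (allFin N) ≡ N ∸ size F
count-not {N} F = sym (trans (cong (_∸ size F) (sym (count-split F))) (m+n∸m≡n (size F) _))

mutual
  fits : {m N : ℕ} → Prescription m N → (Fin N → Bool) → (Fin m → Fin N) → Bool
  fits {zero}  pre F g = true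
  fits {suc m} pre F g = fitsAt (pre zero) (pre ∘ suc) F (g zero) (g ∘ suc)

  fitsAt : {m N : ℕ} → Maybe (Fin N) → Prescription m N → (Fin N → Bool) → Fin N → (Fin m → Fin N) → Bool
  fitsAt (just v) pre F x g = (v == x) ∧ fits pre F g
  fitsAt nothing  pre F x g = not (F x) ∧ fits pre (insert F x) g

mutual
  count-fits : {m N : ℕ} (pre : Prescription m N) (F : Fin N → Bool) →
    count (fits pre F) (allFuns m N) ≡ falling (N ∸ size F) (free pre)
  count-fits {zero}      pre F = refl
  count-fits {suc m} {N} pre F = begin
    count (fits pre F) (allFuns (suc m) N)
      ≡⟨ count-allFuns-suc (fitsAt (pre zero) (pre ∘ suc) F) ⟩
    ∑[ b ∈ allFin N ] count (fitsAt (pre zero) (pre ∘ suc) F b) (allFuns m N)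
      ≡⟨ count-fitsAt (pre zero) (pre ∘ suc) F ⟩
    falling (N ∸ size F) (𝟙 (is-nothing (pre zero)) + free (pre ∘ suc))
      ≡⟨ cong (falling (N ∸ size F)) (∑-allFin-suc (λ i → 𝟙 (is-nothing (pre i)))) ⟨
    falling (N ∸ size F) (free pre) ∎
    where open ≡-Reasoning

  count-fitsAt : {m N : ℕ} (o : Maybe (Fin N)) (pre : Prescription m N) (F : Fin N → Bool) →
    ∑[ b ∈ allFin N ] count (fitsAt o pre F b) (allFuns m N)
      ≡ falling (N ∸ size F) (𝟙 (is-nothing o) + free pre)
  count-fitsAt {m} {N} (just v) pre F = begin
    ∑[ b ∈ allFin N ] count (λ g → (v == b) ∧ fits pre F g) (allFuns m N)
      ≡⟨ ∑-cong (λ b → count-∧ˡ (v == b) (fits pre F) (allFuns m N)) (allFin N) ⟩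
    ∑[ b ∈ allFin N ] (𝟙 (v == b) * count (fits pre F) (allFuns m N))
      ≡⟨ ∑-δ v (λ _ → count (fits pre F) (allFuns m N)) ⟩
    count (fits pre F) (allFuns m N)
      ≡⟨ count-fits pre F ⟩
    falling (N ∸ size F) (free pre) ∎
    where open ≡-Reasoning
  count-fitsAt {m} {N} nothing pre F = begin
    ∑[ b ∈ allFin N ] count (λ g → not (F b) ∧ fits pre (insert F b) g) (allFuns m N)
      ≡⟨ ∑-cong (λ b → count-∧ˡ (not (F b)) (fits pre (insert F b)) (allFuns m N)) (allFin N) ⟩
    ∑[ b ∈ allFin N ] (𝟙 (not (F b)) * count (fits pre (insert F b)) (allFuns m N))
      ≡⟨ ∑-cong smaller (allFin N) ⟩
    ∑[ b ∈ allFin N ] (𝟙 (not (F b)) * falling (N ∸ size F ∸ 1) (free pre))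
      ≡⟨ ∑-*ʳ (𝟙 ∘ not ∘ F) _ (allFin N) ⟩
    count (not ∘ F) (allFin N) * falling (N ∸ size F ∸ 1) (free pre)
      ≡⟨ cong (_* falling (N ∸ size F ∸ 1) (free pre)) (count-not F) ⟩
    falling (N ∸ size F) (suc (free pre)) ∎
    where
    open ≡-Reasoning
    -- Choosing a fresh value b for the first free position uses up one more value.
    smaller : ∀ b → 𝟙 (not (F b)) * count (fits pre (insert F b)) (allFuns m N)
                  ≡ 𝟙 (not (F b)) * falling (N ∸ size F ∸ 1) (free pre)
    smaller b with F b in Fb
    ... | true  = refl
    ... | false = cong (1 *_) (trans (count-fits pre (insert F b)) (cong (λ s → falling s (free pre)) used))
      where
      used : N ∸ size (insert F b) ≡ N ∸ size F ∸ 1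
      used = trans (cong (N ∸_) (trans (size-insert F b Fb) (+-comm 1 (size F)))) (sym (∸-+-assoc N (size F) 1))

Realises : {m N : ℕ} → Prescription m N → (Fin N → Bool) → (Fin m → Fin N) → Set
Realises pre F g =
  Injective _≡_ _≡_ g × (∀ i v → pre i ≡ just v → g i ≡ v) × (∀ i → pre i ≡ nothing → F (g i) ≡ false)

PrescribedIn : {m N : ℕ} → Prescription m N → (Fin N → Bool) → Set
PrescribedIn pre F = ∀ i v → pre i ≡ just v → F v ≡ true

PrescribedDistinct : {m N : ℕ} → Prescription m N → Set
PrescribedDistinct pre = ∀ i j v → pre i ≡ just v → pre j ≡ just v → i ≡ j

realised-value : {m N : ℕ} {pre : Prescription m N} {F : Fin N → Bool} {g : Fin m → Fin N} →
  Realises pre F g → ∀ i → pre i ≡ just (g i) ⊎ F (g i) ≡ false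
realised-value {pre = pre} (_ , prescribed , outside) i with pre i in eq
... | just v  = inj₁ (cong just (sym (prescribed i v eq)))
... | nothing = inj₂ (outside i eq)

injective-cons : {m N : ℕ} {g : Fin (suc m) → Fin N} →
  Injective _≡_ _≡_ (g ∘ suc) → (∀ i → g zero ≢ g (suc i)) → Injective _≡_ _≡_ g
injective-cons inj new {zero}  {zero}  _ = refl
injective-cons inj new {zero}  {suc j} p = ⊥-elim (new j p)
injective-cons inj new {suc i} {zero}  p = ⊥-elim (new i (sym p))
injective-cons inj new {suc i} {suc j} p = cong suc (inj p)

realises-cons : {m N : ℕ} {pre : Prescription (suc m) N} {F F′ : Fin N → Bool} {g : Fin (suc m) → Fin N} →
  (∀ y → F′ y ≡ false → F y ≡ false) →
  (∀ v → pre zero ≡ just v → g zero ≡ v) → (pre zero ≡ nothing → F (g zero) ≡ false) →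
  Realises (pre ∘ suc) F′ (g ∘ suc) → (∀ i → g zero ≢ g (suc i)) → Realises pre F g
realises-cons {pre = pre} {F} {g = g} shrink head-value head-fresh (inj , prescribed , outside) new =
  injective-cons inj new , prescribed′ , outside′
  where
  prescribed′ : ∀ i v → pre i ≡ just v → g i ≡ v
  prescribed′ zero    = head-value
  prescribed′ (suc i) = prescribed i
  outside′ : ∀ i → pre i ≡ nothing → F (g i) ≡ false
  outside′ zero    = head-fresh
  outside′ (suc i) e = shrink _ (outside i e)

fits-sound : {m N : ℕ} {pre : Prescription m N} {F : Fin N → Bool} {g : Fin m → Fin N} →
  PrescribedIn pre F → PrescribedDistinct pre → fits pre F g ≡ true → Realises pre F g
fits-sound {zero} _ _ _ = (λ { {()} }) , (λ ()) , (λ ())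
fits-sound {suc m} {pre = pre} {F} {g} inF distinct ok with pre zero in eq
... | just v = realises-cons {F′ = F} (λ _ h → h) (λ w e → trans g₀≡v (just-injective (trans (sym eq) e)))
                             (λ e → case trans (sym eq) e of λ ()) tail new
  where
  g₀≡v : g zero ≡ v
  g₀≡v = sym (==-true (proj₁ (∧-true ok)))
  tail : Realises (pre ∘ suc) F (g ∘ suc)
  tail = fits-sound (λ i → inF (suc i)) (λ i j w p q → suc-injective (distinct (suc i) (suc j) w p q))
                    (proj₂ (∧-true ok))
  new : ∀ i → g zero ≢ g (suc i)
  new i p with realised-value {pre = pre ∘ suc} {F = F} tail i
  ... | inj₁ pre-i = 0≢1+n (distinct zero (suc i) v eq (trans pre-i (cong just (trans (sym p) g₀≡v))))
  ... | inj₂ F-i   = true≢false (inF zero v eq) (trans (cong F (trans (sym g₀≡v) p)) F-i)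
... | nothing = realises-cons {F′ = insert F (g zero)} (λ y → ∨-false-left {F y})
                              (λ w e → case trans (sym eq) e of λ ()) (λ _ → fresh) tail new
  where
  fresh : F (g zero) ≡ false
  fresh = not-true (proj₁ (∧-true ok))
  tail : Realises (pre ∘ suc) (insert F (g zero)) (g ∘ suc)
  tail = fits-sound (λ i v e → cong (_∨ (g zero == v)) (inF (suc i) v e))
                    (λ i j w p q → suc-injective (distinct (suc i) (suc j) w p q)) (proj₂ (∧-true ok))
  new : ∀ i → g zero ≢ g (suc i)
  new i p with realised-value {pre = pre ∘ suc} {F = insert F (g zero)} tail i
  ... | inj₁ pre-i = true≢false (inF (suc i) (g (suc i)) pre-i) (trans (cong F (sym p)) fresh)
  ... | inj₂ F-i   = true≢false (==-intro p) (∨-false-right {F (g (suc i))} F-i)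

fits-complete : {m N : ℕ} {pre : Prescription m N} {F : Fin N → Bool} {g : Fin m → Fin N} →
  PrescribedIn pre F → Realises pre F g → fits pre F g ≡ true
fits-complete {zero} _ _ = refl
fits-complete {suc m} {pre = pre} {F} {g} inF (inj , prescribed , outside) with pre zero in eq
... | just v rewrite prescribed zero v eq | ==-intro (refl {x = v}) =
  fits-complete (λ i → inF (suc i)) ((λ p → suc-injective (inj p)) , (λ i → prescribed (suc i)) , (λ i → outside (suc i)))
... | nothing rewrite outside zero eq =
  fits-complete inF′ ((λ p → suc-injective (inj p)) , (λ i → prescribed (suc i)) , outside′)
  where
  inF′ : PrescribedIn (pre ∘ suc) (insert F (g zero))
  inF′ i v e rewrite inF (suc i) v e = refl
  outside′ : ∀ i → pre (suc i) ≡ nothing → insert F (g zero) (g (suc i)) ≡ false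
  outside′ i e rewrite outside (suc i) e = ==-false (λ p → 0≢1+n (inj p))

count-realising : {m N : ℕ} (pre : Prescription m N) (F : Fin N → Bool) →
  PrescribedIn pre F → PrescribedDistinct pre → (t : (Fin m → Fin N) → Bool) →
  (∀ g → t g ≡ true → Realises pre F g) → (∀ g → Realises pre F g → t g ≡ true) →
  count t (allFuns m N) ≡ falling (N ∸ size F) (free pre)
count-realising {m} {N} pre F inF distinct t to from =
  trans (∑-cong (λ g → cong 𝟙 (bool-ext (λ h → fits-complete inF (to g h))
                                        (λ h → from g (fits-sound inF distinct h))))
                (allFuns m N))
        (count-fits pre F)

-- Pigeonhole: an injective map Fin n → Fin n is surjective.
perm-surjective : {n : ℕ} (α : Fin n → Fin n) → IsPerm α → ∀ y → Σ (Fin n) λ x → α x ≡ y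
perm-surjective {zero}  α inj ()
perm-surjective {suc n} α inj y with any? (λ x → α x ≟ y)
... | yes hit = hit
... | no miss = ⊥-elim (1+n≰n (injective⇒≤ squeeze-injective))
  where
  avoids : ∀ x → y ≢ α x
  avoids x p = miss (x , sym p)
  squeeze : Fin (suc n) → Fin n
  squeeze x = punchOut (avoids x)
  squeeze-injective : Injective _≡_ _≡_ squeeze
  squeeze-injective {x} {x′} p = inj (punchOut-injective (avoids x) (avoids x′) p)

perm-preimage : {n : ℕ} (α : Fin n → Fin n) → IsPerm α → ∀ y → ∑[ x ∈ allFin n ] 𝟙 (α x == y) ≡ 1
perm-preimage {n} α inj y with perm-surjective α inj y
... | x₀ , refl = trans (∑-cong at-x₀ (allFin n)) (∑-δ₁ x₀)
  where
  at-x₀ : ∀ x → 𝟙 (α x == α x₀) ≡ 𝟙 (x₀ == x)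
  at-x₀ x = cong 𝟙 (trans (==-injective inj x x₀) (==-sym x x₀))

∑-reindex : {n : ℕ} (α : Fin n → Fin n) → IsPerm α → (φ : Fin n → ℕ) →
  ∑[ x ∈ allFin n ] φ (α x) ≡ ∑[ y ∈ allFin n ] φ y
∑-reindex {n} α inj φ = begin
  ∑[ x ∈ allFin n ] φ (α x)
    ≡⟨ ∑-cong (λ x → ∑-δ (α x) φ) (allFin n) ⟨
  ∑[ x ∈ allFin n ] ∑[ y ∈ allFin n ] (𝟙 (α x == y) * φ y)
    ≡⟨ ∑-comm (λ x y → 𝟙 (α x == y) * φ y) (allFin n) (allFin n) ⟩
  ∑[ y ∈ allFin n ] ∑[ x ∈ allFin n ] (𝟙 (α x == y) * φ y)
    ≡⟨ ∑-cong (λ y → trans (∑-*ʳ (λ x → 𝟙 (α x == y)) (φ y) (allFin n))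
                           (trans (cong (_* φ y) (perm-preimage α inj y)) (+-identityʳ (φ y)))) (allFin n) ⟩
  ∑[ y ∈ allFin n ] φ y ∎
  where open ≡-Reasoning

-- Classes of points relative to m special points: zero is "outside",
-- suc j is "the j-th special point".

isSpecial : {m : ℕ} → Fin (suc m) → Bool
isSpecial zero    = false
isSpecial (suc _) = true

module Image {m n : ℕ} (f : Fin m → Fin n) where

  classify : Fin n → Fin (suc m)
  classify y with any? (λ j → f j ≟ y)
  ... | yes (j , _) = suc j
  ... | no _        = zero

  data Classified (y : Fin n) : Fin (suc m) → Set where
    hit  : ∀ j → f j ≡ y → Classified y (suc j)
    miss : (∀ j → f j ≢ y) → Classified y zero

  classified : ∀ y → Classified y (classify y)
  classified y with any? (λ j → f j ≟ y)
  ... | yes (j , fj≡y) = hit j fj≡y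
  ... | no ¬hit        = miss (λ j p → ¬hit (j , p))

  inImage : Fin n → Bool
  inImage y = isSpecial (classify y)

  outside : Fin n → Bool
  outside y = not (inImage y)

  classify-hit : ∀ {y j} → classify y ≡ suc j → f j ≡ y
  classify-hit {y} {j} e with classify y | classified y
  ... | _ | hit j′ p = subst (λ i → f i ≡ y) (suc-injective e) p

  classify-miss : ∀ {y} → inImage y ≡ false → ∀ j → f j ≢ y
  classify-miss {y} e with classify y | classified y
  ... | _ | miss h = h

  inImage-miss : ∀ {y} → (∀ j → f j ≢ y) → inImage y ≡ false
  inImage-miss {y} h with classify y | classified y
  ... | _ | hit j p = ⊥-elim (h j p)
  ... | _ | miss _  = refl

  module _ (f-inj : Injective _≡_ _≡_ f) where

    classify-value : ∀ j → classify (f j) ≡ suc j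
    classify-value j with classify (f j) | classified (f j)
    ... | _ | hit j′ p = cong suc (f-inj p)
    ... | _ | miss h   = ⊥-elim (h j refl)

    classify-== : ∀ y j → (y == f j) ≡ (classify y == suc j)
    classify-== y j = bool-ext (λ h → ==-intro (trans (cong classify (==-true h)) (classify-value j)))
                               (λ h → ==-intro (sym (classify-hit (==-true h))))

    𝟙-inImage : ∀ y → 𝟙 (inImage y) ≡ ∑[ j ∈ allFin m ] 𝟙 (f j == y)
    𝟙-inImage y with classify y | classified y
    ... | _ | hit j refl = sym (trans (∑-cong (λ j′ → cong 𝟙 (trans (==-injective f-inj j′ j) (==-sym j′ j)))
                                              (allFin m))
                                      (∑-δ₁ j))
    ... | _ | miss h     = sym (count-none (λ j → f j == y) (λ j → ==-false (h j)) (allFin m))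

    image-size : count inImage (allFin n) ≡ m
    image-size = begin
      ∑[ y ∈ allFin n ] 𝟙 (inImage y)                    ≡⟨ ∑-cong 𝟙-inImage (allFin n) ⟩
      ∑[ y ∈ allFin n ] ∑[ j ∈ allFin m ] 𝟙 (f j == y)    ≡⟨ ∑-comm (λ y j → 𝟙 (f j == y)) (allFin n) (allFin m) ⟩
      ∑[ j ∈ allFin m ] ∑[ y ∈ allFin n ] 𝟙 (f j == y)    ≡⟨ ∑-cong (λ j → ∑-δ₁ (f j)) (allFin m) ⟩
      ∑[ j ∈ allFin m ] 1                                 ≡⟨ ∑-const m ⟩
      m                                                   ∎
      where open ≡-Reasoning

    outside-size : count outside (allFin n) ≡ n ∸ m
    outside-size = trans (count-not inImage) (cong (n ∸_) image-size)

    ∑-split : (φ : Fin n → ℕ) →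
      ∑[ x ∈ allFin n ] φ x ≡ ∑[ j ∈ allFin m ] φ (f j) + ∑[ x ∈ allFin n ] (𝟙 (outside x) * φ x)
    ∑-split φ = begin
      ∑[ x ∈ allFin n ] φ x
        ≡⟨ ∑-cong sides (allFin n) ⟩
      ∑[ x ∈ allFin n ] (𝟙 (inImage x) * φ x + 𝟙 (outside x) * φ x)
        ≡⟨ ∑-+ (λ x → 𝟙 (inImage x) * φ x) (λ x → 𝟙 (outside x) * φ x) (allFin n) ⟩
      ∑[ x ∈ allFin n ] (𝟙 (inImage x) * φ x) + rest
        ≡⟨ cong (_+ rest) onImage ⟩
      ∑[ j ∈ allFin m ] φ (f j) + rest ∎
      where
      open ≡-Reasoning
      rest : ℕ
      rest = ∑[ x ∈ allFin n ] (𝟙 (outside x) * φ x)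
      sides : ∀ x → φ x ≡ 𝟙 (inImage x) * φ x + 𝟙 (outside x) * φ x
      sides x = sym (trans (sym (*-distribʳ-+ (φ x) (𝟙 (inImage x)) _))
                           (trans (cong (_* φ x) (𝟙-not (inImage x))) (+-identityʳ (φ x))))
      onImage : ∑[ x ∈ allFin n ] (𝟙 (inImage x) * φ x) ≡ ∑[ j ∈ allFin m ] φ (f j)
      onImage = begin
        ∑[ x ∈ allFin n ] (𝟙 (inImage x) * φ x)
          ≡⟨ ∑-cong (λ x → trans (cong (_* φ x) (𝟙-inImage x)) (sym (∑-*ʳ (λ j → 𝟙 (f j == x)) (φ x) (allFin m))))
                    (allFin n) ⟩
        ∑[ x ∈ allFin n ] ∑[ j ∈ allFin m ] (𝟙 (f j == x) * φ x)
          ≡⟨ ∑-comm (λ x j → 𝟙 (f j == x) * φ x) (allFin n) (allFin m) ⟩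
        ∑[ j ∈ allFin m ] ∑[ x ∈ allFin n ] (𝟙 (f j == x) * φ x)
          ≡⟨ ∑-cong (λ j → ∑-δ (f j) φ) (allFin m) ⟩
        ∑[ j ∈ allFin m ] φ (f j) ∎

along : {m N : ℕ} → (Fin m → Fin N) → Fin (suc m) → Maybe (Fin N)
along h zero    = nothing
along h (suc j) = just (h j)

along-just : {m N : ℕ} {h : Fin m → Fin N} {c : Fin (suc m)} {v : Fin N} →
  along h c ≡ just v → Σ (Fin m) λ j → c ≡ suc j × h j ≡ v
along-just {c = suc j} refl = j , refl , refl

along-nothing : {m N : ℕ} {h : Fin m → Fin N} {c : Fin (suc m)} → along h c ≡ nothing → c ≡ zero
along-nothing {c = zero} refl = refl

is-nothing-along : {m N : ℕ} (h : Fin m → Fin N) (c : Fin (suc m)) → is-nothing (along h c) ≡ not (isSpecial c)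
is-nothing-along h zero    = refl
is-nothing-along h (suc j) = refl

isSpecial-false : {m : ℕ} {c : Fin (suc m)} → isSpecial c ≡ false → c ≡ zero
isSpecial-false {c = zero} _ = refl

injective? : {k n : ℕ} (g : Fin k → Fin n) → Dec (Injective _≡_ _≡_ g)
injective? g = map′ (λ h {i} {j} → h i j) (λ h i j → h) (all? λ i → all? λ j → (g i ≟ g j) →-dec (i ≟ j))

Valid : {k m : ℕ} → (Fin k → Fin (suc m)) → Set
Valid p = ∀ i i′ j → p i ≡ suc j → p i′ ≡ suc j → i ≡ i′

valid? : {k m : ℕ} (p : Fin k → Fin (suc m)) → Dec (Valid p)
valid? p = all? λ i → all? λ i′ → all? λ j → (p i ≟ suc j) →-dec ((p i′ ≟ suc j) →-dec (i ≟ i′))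

outsideCount : {k m : ℕ} → (Fin k → Fin (suc m)) → ℕ
outsideCount {k} p = count (λ i → not (isSpecial (p i))) (allFin k)

module SpecialPoints {m n : ℕ} (pts : Fin m → Fin n) (pts-inj : Injective _≡_ _≡_ pts) where
  open Image pts

  extending : (g : Fin m → Fin n) → Prescription n n
  extending g i = along g (classify i)

  module _ {g : Fin m → Fin n} (g-inj : Injective _≡_ _≡_ g) where

    extending-in-image : PrescribedIn (extending g) (Image.inImage g)
    extending-in-image i v e with along-just {c = classify i} e
    ... | j , _ , refl = cong isSpecial (Image.classify-value g g-inj j)

    extending-distinct : PrescribedDistinct (extending g)
    extending-distinct i i′ v e e′ with along-just {c = classify i} e | along-just {c = classify i′} e′
    ... | j , ci , gj | j′ , ci′ , gj′ =
      trans (sym (classify-hit ci)) (trans (cong pts (g-inj (trans gj (sym gj′)))) (classify-hit ci′))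

  extending-sound : (g : Fin m → Fin n) (α : Fin n → Fin n) →
    does (isPerm? α) ∧ ((α ∘ pts) ≐ g) ≡ true → Realises (extending g) (Image.inImage g) α
  extending-sound g α h = perm , prescribed , outside′
    where
    perm : IsPerm α
    perm = does-true (isPerm? α) (proj₁ (∧-true h))
    agree : ∀ j → α (pts j) ≡ g j
    agree = ≐-sound (proj₂ (∧-true h))
    prescribed : ∀ i v → extending g i ≡ just v → α i ≡ v
    prescribed i v e with along-just {c = classify i} e
    ... | j , ci , gj = trans (cong α (sym (classify-hit ci))) (trans (agree j) gj)
    outside′ : ∀ i → extending g i ≡ nothing → Image.inImage g (α i) ≡ false
    outside′ i e = Image.inImage-miss g λ j gj≡αi →
      classify-miss (cong isSpecial (along-nothing {c = classify i} e)) j (perm (trans (agree j) gj≡αi))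

  extending-complete : (g : Fin m → Fin n) (α : Fin n → Fin n) →
    Realises (extending g) (Image.inImage g) α → does (isPerm? α) ∧ ((α ∘ pts) ≐ g) ≡ true
  extending-complete g α (perm , prescribed , _) =
    cong₂ _∧_ (dec-true (isPerm? α) perm)
              (≐-complete (λ j → prescribed (pts j) (g j) (cong (along g) (classify-value pts-inj j))))

  count-extensions : (g : Fin m → Fin n) →
    count (λ α → does (isPerm? α) ∧ ((α ∘ pts) ≐ g)) (allFuns n n) ≡ 𝟙 (does (injective? g)) * (n ∸ m) !
  count-extensions g = by-injectivity (injective? g)
    where
    by-injectivity : (d : Dec (Injective _≡_ _≡_ g)) →
      count (λ α → does (isPerm? α) ∧ ((α ∘ pts) ≐ g)) (allFuns n n) ≡ 𝟙 (does d) * (n ∸ m) !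
    by-injectivity (no ¬inj) = count-none _ forced (allFuns n n)
      where
      forced : ∀ α → does (isPerm? α) ∧ ((α ∘ pts) ≐ g) ≡ false
      forced α = ∧-false λ perm agree → ¬inj λ {i} {j} p →
        pts-inj (does-true (isPerm? α) perm (trans (≐-sound agree i) (trans p (sym (≐-sound agree j)))))
    by-injectivity (yes g-inj) = begin
      count (λ α → does (isPerm? α) ∧ ((α ∘ pts) ≐ g)) (allFuns n n)
        ≡⟨ count-realising (extending g) (Image.inImage g) (extending-in-image g-inj) (extending-distinct g-inj)
                           _ (extending-sound g) (extending-complete g) ⟩
      falling (n ∸ size (Image.inImage g)) (free (extending g))
        ≡⟨ cong₂ falling (cong (n ∸_) (Image.image-size g g-inj)) (trans free-outside (outside-size pts-inj)) ⟩
      falling (n ∸ m) (n ∸ m)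
        ≡⟨ trans (falling-diag (n ∸ m)) (sym (+-identityʳ _)) ⟩
      1 * (n ∸ m) ! ∎
      where
      open ≡-Reasoning
      free-outside : free (extending g) ≡ count outside (allFin n)
      free-outside = ∑-cong (λ i → cong 𝟙 (is-nothing-along g (classify i))) (allFin n)

  following : {k : ℕ} → (Fin k → Fin (suc m)) → Prescription k n
  following p i = along pts (p i)

  following-in-image : {k : ℕ} (p : Fin k → Fin (suc m)) → PrescribedIn (following p) inImage
  following-in-image p i v e with along-just {c = p i} e
  ... | j , _ , refl = cong isSpecial (classify-value pts-inj j)

  following-distinct : {k : ℕ} (p : Fin k → Fin (suc m)) → Valid p → PrescribedDistinct (following p)
  following-distinct p valid i i′ v e e′ with along-just {c = p i} e | along-just {c = p i′} e′
  ... | j , pi , ptsj | j′ , pi′ , ptsj′ = valid i i′ j pi (trans pi′ (cong suc (pts-inj (trans ptsj′ (sym ptsj)))))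

  following-sound : {k : ℕ} (p : Fin k → Fin (suc m)) (g : Fin k → Fin n) →
    does (injective? g) ∧ ((classify ∘ g) ≐ p) ≡ true → Realises (following p) inImage g
  following-sound p g h = does-true (injective? g) (proj₁ (∧-true h)) , prescribed , outside′
    where
    agree : ∀ i → classify (g i) ≡ p i
    agree = ≐-sound (proj₂ (∧-true h))
    prescribed : ∀ i v → following p i ≡ just v → g i ≡ v
    prescribed i v e with along-just {c = p i} e
    ... | j , pi , ptsj = trans (sym (classify-hit (trans (agree i) pi))) ptsj
    outside′ : ∀ i → following p i ≡ nothing → inImage (g i) ≡ false
    outside′ i e = cong isSpecial (trans (agree i) (along-nothing {c = p i} e))

  following-complete : {k : ℕ} (p : Fin k → Fin (suc m)) (g : Fin k → Fin n) →
    Realises (following p) inImage g → does (injective? g) ∧ ((classify ∘ g) ≐ p) ≡ true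
  following-complete p g (inj , prescribed , outside′) = cong₂ _∧_ (dec-true (injective? g) inj) (≐-complete class-of)
    where
    class-of : ∀ i → classify (g i) ≡ p i
    class-of i with p i in e
    ... | zero  = isSpecial-false (outside′ i (cong (along pts) e))
    ... | suc j = trans (cong classify (prescribed i (pts j) (cong (along pts) e))) (classify-value pts-inj j)

  count-patterns : {k : ℕ} (p : Fin k → Fin (suc m)) →
    count (λ g → does (injective? g) ∧ ((classify ∘ g) ≐ p)) (allFuns k n)
      ≡ 𝟙 (does (valid? p)) * falling (n ∸ m) (outsideCount p)
  count-patterns {k} p = by-validity (valid? p)
    where
    by-validity : (d : Dec (Valid p)) →
      count (λ g → does (injective? g) ∧ ((classify ∘ g) ≐ p)) (allFuns k n)
        ≡ 𝟙 (does d) * falling (n ∸ m) (outsideCount p)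
    by-validity (no ¬valid) = count-none _ forced (allFuns k n)
      where
      forced : ∀ g → does (injective? g) ∧ ((classify ∘ g) ≐ p) ≡ false
      forced g = ∧-false λ inj agree → ¬valid λ i i′ j pi pi′ →
        does-true (injective? g) inj
          (trans (sym (classify-hit (trans (≐-sound agree i) pi))) (classify-hit (trans (≐-sound agree i′) pi′)))
    by-validity (yes valid) = begin
      count (λ g → does (injective? g) ∧ ((classify ∘ g) ≐ p)) (allFuns k n)
        ≡⟨ count-realising (following p) inImage (following-in-image p) (following-distinct p valid)
                           _ (following-sound p) (following-complete p) ⟩
      falling (n ∸ size inImage) (free (following p))
        ≡⟨ cong₂ falling (cong (n ∸_) (image-size pts-inj))
                         (∑-cong (λ i → cong 𝟙 (is-nothing-along pts (p i))) (allFin k)) ⟩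
      falling (n ∸ m) (outsideCount p)
        ≡⟨ +-identityʳ _ ⟨
      1 * falling (n ∸ m) (outsideCount p) ∎
      where open ≡-Reasoning

module Weight {m : ℕ} (next : Fin m → Fin m) where

  -- Whether the classes c, c′ of α(j), α(next j) fail to be consistent with β.
  mismatch : Fin (suc m) → Fin (suc m) → ℕ
  mismatch zero    _ = 1
  mismatch (suc j) c = 𝟙 (not (c == suc (next j)))

  weight : (Fin m → Fin (suc m)) → ℕ
  weight p = ∑[ j ∈ allFin m ] mismatch (p j) (p (next j)) + outsideCount p

  weight-resp : {p q : Fin m → Fin (suc m)} → (∀ j → p j ≡ q j) → weight p ≡ weight q
  weight-resp e = cong₂ _+_ (∑-cong (λ j → cong₂ mismatch (e j) (e (next j))) (allFin m))
                            (∑-cong (λ j → cong (𝟙 ∘ not ∘ isSpecial) (e j)) (allFin m))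

  weightIs : ℕ → (Fin m → Fin (suc m)) → Bool
  weightIs k p = does (weight p ≟ℕ k)

  weightIs-resp : ∀ k {p q : Fin m → Fin (suc m)} → (∀ j → p j ≡ q j) → weightIs k p ≡ weightIs k q
  weightIs-resp k e = cong (λ w → does (w ≟ℕ k)) (weight-resp e)

  patternSum : ℕ → ℕ → ℕ
  patternSum k r = ∑[ p ∈ allFuns m (suc m) ] (𝟙 (weightIs k p ∧ does (valid? p)) * falling r (outsideCount p))

module Hamming {m n : ℕ} (pts : Fin m → Fin n) (pts-inj : Injective _≡_ _≡_ pts)
               (next : Fin m → Fin m) (next-moves : ∀ j → next j ≢ j)
               (β : Fin n → Fin n) (β-pts : ∀ j → β (pts j) ≡ pts (next j))
               (β-fix : ∀ x → (∀ j → pts j ≢ x) → β x ≡ x) where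
  open Image pts
  open Weight next

  moved : ∀ y → not (y == β y) ≡ inImage y
  moved y with classify y | classified y
  ... | _ | hit j refl = cong not (==-false λ p → next-moves j (pts-inj (sym (trans p (β-pts j)))))
  ... | _ | miss h     = cong not (==-intro (sym (β-fix y h)))

  module _ (α : Fin n → Fin n) (α-perm : IsPerm α) where

    mismatches : Fin n → ℕ
    mismatches x = 𝟙 (not (α (β x) == β (α x)))

    profile : Fin m → Fin (suc m)
    profile j = classify (α (pts j))

    -- At a special point, β(α(pts j)) is pts (next i) if α(pts j) = pts i and
    -- α(pts j) itself if it is outside.
    on-special : ∀ j → mismatches (pts j) ≡ mismatch (profile j) (profile (next j))
    on-special j rewrite β-pts j with classify (α (pts j)) | classified (α (pts j))
    ... | _ | hit i p rewrite sym p | β-pts i = cong (𝟙 ∘ not) (classify-== pts-inj (α (pts (next j))) (next i))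
    ... | _ | miss h rewrite β-fix (α (pts j)) h =
      cong (𝟙 ∘ not) (==-false λ p → next-moves j (pts-inj (α-perm p)))

    -- Off the special points the mismatches are the points that α sends into
    -- the special set; by counting preimages there are as many as special
    -- points sent outside.
    off-special : ∑[ x ∈ allFin n ] (𝟙 (outside x) * mismatches x) ≡ outsideCount profile
    off-special = +-cancelˡ-≡ inside _ _ (begin
      inside + ∑[ x ∈ allFin n ] (𝟙 (outside x) * mismatches x)
        ≡⟨ cong (inside +_) (∑-cong fixed (allFin n)) ⟩
      inside + ∑[ x ∈ allFin n ] (𝟙 (outside x) * 𝟙 (inImage (α x)))
        ≡⟨ ∑-split pts-inj (λ x → 𝟙 (inImage (α x))) ⟨
      ∑[ x ∈ allFin n ] 𝟙 (inImage (α x))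
        ≡⟨ ∑-reindex α α-perm (𝟙 ∘ inImage) ⟩
      count inImage (allFin n)
        ≡⟨ trans (image-size pts-inj) (sym (count-split (inImage ∘ α ∘ pts))) ⟩
      inside + outsideCount profile ∎)
      where
      open ≡-Reasoning
      inside : ℕ
      inside = ∑[ j ∈ allFin m ] 𝟙 (inImage (α (pts j)))
      fixed : ∀ x → 𝟙 (outside x) * mismatches x ≡ 𝟙 (outside x) * 𝟙 (inImage (α x))
      fixed x with outside x in out
      ... | false = refl
      ... | true  = trans (cong (λ z → 𝟙 (not (α z == β (α x))) + 0) (β-fix x (classify-miss (not-true out))))
                          (cong (λ b → 𝟙 b + 0) (moved (α x)))

    hamming : H (α ∘ β) (β ∘ α) ≡ weight profile
    hamming = begin
      H (α ∘ β) (β ∘ α)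
        ≡⟨ length-filter (λ x → ¬? (α (β x) ≟ β (α x))) (allFin n) ⟩
      ∑[ x ∈ allFin n ] mismatches x
        ≡⟨ ∑-split pts-inj mismatches ⟩
      ∑[ j ∈ allFin m ] mismatches (pts j) + ∑[ x ∈ allFin n ] (𝟙 (outside x) * mismatches x)
        ≡⟨ cong₂ _+_ (∑-cong on-special (allFin m)) off-special ⟩
      weight profile ∎
      where open ≡-Reasoning

  open SpecialPoints pts pts-inj

  count-injections-of-weight : ∀ k →
    count (λ g → does (injective? g) ∧ weightIs k (classify ∘ g)) (allFuns m n) ≡ patternSum k (n ∸ m)
  count-injections-of-weight k = begin
    count (λ g → does (injective? g) ∧ weightIs k (classify ∘ g)) (allFuns m n)
      ≡⟨ count-by-key (classify ∘_) (weightIs k) (weightIs-resp k) (does ∘ injective?) (allFuns m n) ⟩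
    ∑[ p ∈ allFuns m (suc m) ] (𝟙 (weightIs k p) * count (λ g → does (injective? g) ∧ ((classify ∘ g) ≐ p)) (allFuns m n))
      ≡⟨ ∑-cong (λ p → trans (cong (𝟙 (weightIs k p) *_) (count-patterns p))
                             (sym (𝟙-∧-* (weightIs k p) (does (valid? p)) _)))
                (allFuns m (suc m)) ⟩
    patternSum k (n ∸ m) ∎
    where open ≡-Reasoning

  count-k-commuting : ∀ k → c k β ≡ patternSum k (n ∸ m) * (n ∸ m) !
  count-k-commuting k = begin
    c k β
      ≡⟨ length-filter (λ α → isPerm? α ×-dec (H (α ∘ β) (β ∘ α) ≟ℕ k)) (allFuns n n) ⟩
    count (λ α → does (isPerm? α) ∧ does (H (α ∘ β) (β ∘ α) ≟ℕ k)) (allFuns n n)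
      ≡⟨ ∑-cong (λ α → cong 𝟙 (by-hamming α (isPerm? α))) (allFuns n n) ⟩
    count (λ α → does (isPerm? α) ∧ W (α ∘ pts)) (allFuns n n)
      ≡⟨ count-by-key (λ α → α ∘ pts) W (λ e → weightIs-resp k (λ j → cong classify (e j)))
                      (does ∘ isPerm?) (allFuns n n) ⟩
    ∑[ g ∈ allFuns m n ] (𝟙 (W g) * count (λ α → does (isPerm? α) ∧ ((α ∘ pts) ≐ g)) (allFuns n n))
      ≡⟨ ∑-cong (λ g → cong (𝟙 (W g) *_) (count-extensions g)) (allFuns m n) ⟩
    ∑[ g ∈ allFuns m n ] (𝟙 (W g) * (𝟙 (does (injective? g)) * (n ∸ m) !))
      ≡⟨ ∑-cong (λ g → trans (sym (𝟙-∧-* (W g) (does (injective? g)) _))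
                             (cong (λ b → 𝟙 b * (n ∸ m) !) (∧-comm (W g) _))) (allFuns m n) ⟩
    ∑[ g ∈ allFuns m n ] (𝟙 (does (injective? g) ∧ W g) * (n ∸ m) !)
      ≡⟨ ∑-*ʳ (λ g → 𝟙 (does (injective? g) ∧ W g)) _ (allFuns m n) ⟩
    count (λ g → does (injective? g) ∧ W g) (allFuns m n) * (n ∸ m) !
      ≡⟨ cong (_* (n ∸ m) !) (count-injections-of-weight k) ⟩
    patternSum k (n ∸ m) * (n ∸ m) ! ∎
    where
    open ≡-Reasoning
    W : (Fin m → Fin n) → Bool
    W g = weightIs k (classify ∘ g)
    by-hamming : ∀ α (d : Dec (IsPerm α)) → does d ∧ does (H (α ∘ β) (β ∘ α) ≟ℕ k) ≡ does d ∧ W (α ∘ pts)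
    by-hamming α (yes perm) = cong (λ h → does (h ≟ℕ k)) (hamming α perm)
    by-hamming α (no _)     = refl

∑-δ-value : {K : ℕ} (v : ℕ) (φ : ℕ → ℕ) → v ≤ K →
  ∑[ j ∈ allFin (suc K) ] (𝟙 (does (v ≟ℕ toℕ j)) * φ (toℕ j)) ≡ φ v
∑-δ-value {K} v φ v≤K = begin
  ∑[ j ∈ allFin (suc K) ] (𝟙 (does (v ≟ℕ toℕ j)) * φ (toℕ j))
    ≡⟨ ∑-cong (λ j → cong (λ b → 𝟙 b * φ (toℕ j)) (same j)) (allFin (suc K)) ⟩
  ∑[ j ∈ allFin (suc K) ] (𝟙 (y == j) * φ (toℕ j))
    ≡⟨ ∑-δ y (φ ∘ toℕ) ⟩
  φ (toℕ y)
    ≡⟨ cong φ (toℕ-fromℕ< (s≤s v≤K)) ⟩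
  φ v ∎
  where
  open ≡-Reasoning
  y : Fin (suc K)
  y = fromℕ< (s≤s v≤K)
  same : ∀ j → does (v ≟ℕ toℕ j) ≡ (y == j)
  same j = bool-ext (λ h → ==-intro (toℕ-injective (trans (toℕ-fromℕ< (s≤s v≤K)) (does-true (v ≟ℕ toℕ j) h))))
                    (λ h → dec-true (v ≟ℕ toℕ j) (trans (sym (toℕ-fromℕ< (s≤s v≤K))) (cong toℕ (==-true h))))

∑-by-value : {A : Set} {K : ℕ} (xs : List A) (w v : A → ℕ) (φ : ℕ → ℕ) → (∀ x → v x ≤ K) →
  ∑[ x ∈ xs ] (w x * φ (v x))
    ≡ ∑[ j ∈ allFin (suc K) ] (∑[ x ∈ xs ] (𝟙 (does (v x ≟ℕ toℕ j)) * w x) * φ (toℕ j))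
∑-by-value {A} {K} xs w v φ bounded = begin
  ∑[ x ∈ xs ] (w x * φ (v x))
    ≡⟨ ∑-cong (λ x → cong (w x *_) (∑-δ-value (v x) φ (bounded x))) xs ⟨
  ∑[ x ∈ xs ] (w x * ∑[ j ∈ allFin (suc K) ] (δ x j * φ (toℕ j)))
    ≡⟨ ∑-cong (λ x → ∑-*ˡ (w x) (λ j → δ x j * φ (toℕ j)) (allFin (suc K))) xs ⟨
  ∑[ x ∈ xs ] ∑[ j ∈ allFin (suc K) ] (w x * (δ x j * φ (toℕ j)))
    ≡⟨ ∑-comm (λ x j → w x * (δ x j * φ (toℕ j))) xs (allFin (suc K)) ⟩
  ∑[ j ∈ allFin (suc K) ] ∑[ x ∈ xs ] (w x * (δ x j * φ (toℕ j)))
    ≡⟨ ∑-cong (λ j → trans (∑-cong (λ x → reorder (w x) (δ x j) (φ (toℕ j))) xs)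
                           (∑-*ʳ (λ x → δ x j * w x) (φ (toℕ j)) xs)) (allFin (suc K)) ⟩
  ∑[ j ∈ allFin (suc K) ] (∑[ x ∈ xs ] (δ x j * w x) * φ (toℕ j)) ∎
  where
  open ≡-Reasoning
  δ : A → Fin (suc K) → ℕ
  δ x j = 𝟙 (does (v x ≟ℕ toℕ j))
  reorder : ∀ a b c → a * (b * c) ≡ b * a * c
  reorder = solve-∀

count-≤ : {n : ℕ} (t : Fin n → Bool) → count t (allFin n) ≤ n
count-≤ t = subst (count t (allFin _) ≤_) (count-split t) (m≤m+n _ _)

choose-2 : ∀ r → ((2 + r) C 2) * 2 ≡ (2 + r) * (1 + r)
choose-2 zero    = cong (_* 2) (nCn≡1 2)
choose-2 (suc r) = begin
  ((3 + r) C 2) * 2                        ≡⟨ cong (_* 2) (nCk+nC[k+1]≡[n+1]C[k+1] (2 + r) 1) ⟨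
  ((2 + r) C 1 + (2 + r) C 2) * 2          ≡⟨ *-distribʳ-+ 2 ((2 + r) C 1) ((2 + r) C 2) ⟩
  ((2 + r) C 1) * 2 + ((2 + r) C 2) * 2    ≡⟨ cong₂ _+_ (cong (_* 2) (nC1≡n (2 + r))) (choose-2 r) ⟩
  (2 + r) * 2 + (2 + r) * (1 + r)          ≡⟨ arith r ⟩
  (3 + r) * (2 + r)                        ∎
  where
  open ≡-Reasoning
  arith : ∀ r → (2 + r) * 2 + (2 + r) * (1 + r) ≡ (3 + r) * (2 + r)
  arith = solve-∀

choose-3 : ∀ r → ((3 + r) C 3) * 6 ≡ (3 + r) * ((2 + r) * (1 + r))
choose-3 zero    = cong (_* 6) (nCn≡1 3)
choose-3 (suc r) = begin
  ((4 + r) C 3) * 6                                      ≡⟨ cong (_* 6) (nCk+nC[k+1]≡[n+1]C[k+1] (3 + r) 2) ⟨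
  ((3 + r) C 2 + (3 + r) C 3) * 6                        ≡⟨ *-distribʳ-+ 6 ((3 + r) C 2) ((3 + r) C 3) ⟩
  ((3 + r) C 2) * 6 + ((3 + r) C 3) * 6                  ≡⟨ cong (_+ ((3 + r) C 3) * 6) (*-assoc ((3 + r) C 2) 2 3) ⟨
  ((3 + r) C 2) * 2 * 3 + ((3 + r) C 3) * 6              ≡⟨ cong₂ _+_ (cong (_* 3) (choose-2 (suc r))) (choose-3 r) ⟩
  (3 + r) * (2 + r) * 3 + (3 + r) * ((2 + r) * (1 + r))  ≡⟨ arith r ⟩
  (4 + r) * ((3 + r) * (2 + r))                          ∎
  where
  open ≡-Reasoning
  arith : ∀ r → (3 + r) * (2 + r) * 3 + (3 + r) * ((2 + r) * (1 + r)) ≡ (4 + r) * ((3 + r) * (2 + r))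
  arith = solve-∀

next₃ : Fin 3 → Fin 3
next₃ zero             = suc zero
next₃ (suc zero)       = suc (suc zero)
next₃ (suc (suc zero)) = zero

next₃-moves : ∀ j → next₃ j ≢ j
next₃-moves zero             ()
next₃-moves (suc zero)       ()
next₃-moves (suc (suc zero)) ()

open Weight next₃ using (patternSum; weightIs)

patternSum-by-outside : ∀ k r → patternSum k r ≡
  ∑[ j ∈ allFin 4 ] (∑[ p ∈ allFuns 3 4 ] (𝟙 (does (outsideCount p ≟ℕ toℕ j)) * 𝟙 (weightIs k p ∧ does (valid? p)))
                     * falling r (toℕ j))
patternSum-by-outside k r =
  ∑-by-value (allFuns 3 4) (λ p → 𝟙 (weightIs k p ∧ does (valid? p))) outsideCount (falling r)
             (λ p → count-≤ (λ i → not (isSpecial (p i))))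

-- The coefficients for k = 0, 3, 4, 5, 6 are (3,0,0,0), (3,9,0,0), (0,9,0,0),
-- (0,0,9,0) and (0,0,0,1); no valid pattern has weight 7 or more.

patternSum-0 : ∀ r → patternSum 0 r ≡ 3
patternSum-0 r = patternSum-by-outside 0 r

patternSum-3 : ∀ r → patternSum 3 r ≡ (3 * r + 1) * 3
patternSum-3 r = trans (patternSum-by-outside 3 r) (arith r (falling r 2) (falling r 3))
  where
  arith : ∀ r x₂ x₃ → 3 * 1 + (9 * (r * 1) + (0 * x₂ + (0 * x₃ + 0))) ≡ (3 * r + 1) * 3
  arith = solve-∀

patternSum-4 : ∀ r → patternSum 4 r ≡ 3 * r * 3
patternSum-4 r = trans (patternSum-by-outside 4 r) (arith r (falling r 2) (falling r 3))
  where
  arith : ∀ r x₂ x₃ → 0 * 1 + (9 * (r * 1) + (0 * x₂ + (0 * x₃ + 0))) ≡ 3 * r * 3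
  arith = solve-∀

patternSum-5 : ∀ r → 2 ≤ r → patternSum 5 r ≡ 6 * (r C 2) * 3
patternSum-5 (suc (suc r)) (s≤s (s≤s z≤n)) = begin
  patternSum 5 (2 + r)                     ≡⟨ patternSum-by-outside 5 (2 + r) ⟩
  0 * 1 + (0 * ((2 + r) * 1) + (9 * ((2 + r) * ((1 + r) * 1)) + (0 * falling (2 + r) 3 + 0)))
                                           ≡⟨ arith r (falling (2 + r) 3) ⟩
  9 * ((2 + r) * (1 + r))                  ≡⟨ cong (9 *_) (choose-2 r) ⟨
  9 * (((2 + r) C 2) * 2)                    ≡⟨ rescale ((2 + r) C 2) ⟩
  6 * ((2 + r) C 2) * 3                    ∎
  where
  open ≡-Reasoning
  arith : ∀ r x₃ → 0 * 1 + (0 * ((2 + r) * 1) + (9 * ((2 + r) * ((1 + r) * 1)) + (0 * x₃ + 0)))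
                   ≡ 9 * ((2 + r) * (1 + r))
  arith = solve-∀
  rescale : ∀ x → 9 * (x * 2) ≡ 6 * x * 3
  rescale = solve-∀

patternSum-6 : ∀ r → 3 ≤ r → patternSum 6 r ≡ 2 * (r C 3) * 3
patternSum-6 (suc (suc (suc r))) (s≤s (s≤s (s≤s z≤n))) = begin
  patternSum 6 (3 + r)                     ≡⟨ patternSum-by-outside 6 (3 + r) ⟩
  0 * 1 + (0 * ((3 + r) * 1) + (0 * ((3 + r) * ((2 + r) * 1)) + (1 * ((3 + r) * ((2 + r) * ((1 + r) * 1))) + 0)))
                                           ≡⟨ arith r ⟩
  (3 + r) * ((2 + r) * (1 + r))            ≡⟨ choose-3 r ⟨
  ((3 + r) C 3) * 6                          ≡⟨ rescale ((3 + r) C 3) ⟩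
  2 * ((3 + r) C 3) * 3                    ∎
  where
  open ≡-Reasoning
  arith : ∀ r → 0 * 1 + (0 * ((3 + r) * 1) + (0 * ((3 + r) * ((2 + r) * 1)) + (1 * ((3 + r) * ((2 + r) * ((1 + r) * 1))) + 0)))
                ≡ (3 + r) * ((2 + r) * (1 + r))
  arith = solve-∀
  rescale : ∀ x → x * 6 ≡ 2 * x * 3
  rescale = solve-∀

patternSum-large : ∀ k r → 7 ≤ k → patternSum k r ≡ 0
patternSum-large (suc (suc (suc (suc (suc (suc (suc k))))))) r (s≤s (s≤s (s≤s (s≤s (s≤s (s≤s (s≤s z≤n))))))) = refl

module ThreeCycle {n : ℕ} {β : Fin n → Fin n} {a b d : Fin n} (ab : a ≢ b) (bd : b ≢ d) (ad : a ≢ d)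
                  (βa : β a ≡ b) (βb : β b ≡ d) (βd : β d ≡ a)
                  (fix : ∀ x → x ≢ a → x ≢ b → x ≢ d → β x ≡ x) where

  points : Fin 3 → Fin n
  points zero             = a
  points (suc zero)       = b
  points (suc (suc zero)) = d

  points-injective : Injective _≡_ _≡_ points
  points-injective {zero}             {zero}             _ = refl
  points-injective {zero}             {suc zero}         p = ⊥-elim (ab p)
  points-injective {zero}             {suc (suc zero)}   p = ⊥-elim (ad p)
  points-injective {suc zero}         {zero}             p = ⊥-elim (ab (sym p))
  points-injective {suc zero}         {suc zero}         _ = refl
  points-injective {suc zero}         {suc (suc zero)}   p = ⊥-elim (bd p)
  points-injective {suc (suc zero)}   {zero}             p = ⊥-elim (ad (sym p))
  points-injective {suc (suc zero)}   {suc zero}         p = ⊥-elim (bd (sym p))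
  points-injective {suc (suc zero)}   {suc (suc zero)}   _ = refl

  β-points : ∀ j → β (points j) ≡ points (next₃ j)
  β-points zero             = βa
  β-points (suc zero)       = βb
  β-points (suc (suc zero)) = βd

  β-fix : ∀ x → (∀ j → points j ≢ x) → β x ≡ x
  β-fix x away = fix x (λ p → away zero (sym p)) (λ p → away (suc zero) (sym p)) (λ p → away (suc (suc zero)) (sym p))

  open Hamming points points-injective next₃ next₃-moves β β-points β-fix public using (count-k-commuting)

theorem3p3 : (n : ℕ) (β : Fin n → Fin n) → IsPerm β → Is3Cycle β →
    (3 ≤ n → c 0 β ≡ 3 * ((n ∸ 3) !)) ×
    (3 ≤ n → c 3 β ≡ (3 * (n ∸ 3) + 1) * (3 * ((n ∸ 3) !))) ×
    (4 ≤ n → c 4 β ≡ (3 * (n ∸ 3)) * (3 * ((n ∸ 3) !))) ×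
    (5 ≤ n → c 5 β ≡ (6 * ((n ∸ 3) C 2)) * (3 * ((n ∸ 3) !))) ×
    (6 ≤ n → c 6 β ≡ (2 * ((n ∸ 3) C 3)) * (3 * ((n ∸ 3) !))) ×
    ((k : ℕ) → 7 ≤ k → k ≤ n → c k β ≡ 0)
theorem3p3 n β _ (a , b , d , ab , bd , ad , βa , βb , βd , fix) =
  (λ _ → trans (counts 0) (cong (_* (r !)) (patternSum-0 r))) ,
  (λ _ → trans (counts 3) (scaled (3 * r + 1) (patternSum-3 r))) ,
  (λ _ → trans (counts 4) (scaled (3 * r) (patternSum-4 r))) ,
  (λ 5≤n → trans (counts 5) (scaled (6 * (r C 2)) (patternSum-5 r (∸-monoˡ-≤ 3 5≤n)))) ,
  (λ 6≤n → trans (counts 6) (scaled (2 * (r C 3)) (patternSum-6 r (∸-monoˡ-≤ 3 6≤n)))) ,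
  (λ k 7≤k _ → trans (counts k) (cong (_* (r !)) (patternSum-large k r 7≤k)))
  where
  r : ℕ
  r = n ∸ 3
  counts : ∀ k → c k β ≡ patternSum k r * r !
  counts = ThreeCycle.count-k-commuting ab bd ad βa βb βd fix
  scaled : ∀ {t} e → t ≡ e * 3 → t * r ! ≡ e * (3 * r !)
  scaled e t≡e*3 = trans (cong (_* r !) t≡e*3) (*-assoc e 3 (r !))
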